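{- Let $e$ be a function assigning to each integer $k\geq 1$ a real number $e(k)>0$ such that every graph on $N$ vertices of VC-dimension at most $k$ contains a clique or an independent set of size at least $N^{e(k)}$. Let $d \geq 0$ be an integer and let $A$ be a switch matrix of size $n$ of VC-dimension at most $d$. Then $A$ contains a square $(\alpha,\beta,*)$-submatrix with $\alpha \neq \beta$ of size at least $n^{e(4d+3)}$.
   Context: A matrix $B \in \{0,1\}^{s \times 2s}$ is a switch matrix of size $s$ if (i) for all $i\in[s]$, $B_{i,2i-1}=0$ and $B_{i,2i}=1$, and (ii) for all $i<j$ in $[s]$, $B_{i,2j-1}=B_{i,2j}$. A submatrix is obtained by permuting and deleting rows and columns. For $\alpha,\beta\in\{0,1\}$, a square matrix $M$ is an $(\alpha,\beta,*)$-matrix if $M_{i,j}=\alpha$ for all $i<j$ and $M_{i,i}=\beta$ for all $i$ (entries below the diagonal are unrestricted). VC-dimension: for a set system $(X,\mathcal{F})$, $Y\subseteq X$ is shattered if $|\{Y\cap S: S\in\mathcal{F}\}|=2^{|Y|}$, and the VC-dimension is the largest size of a shattered set; for a graph, this is applied to its neighbourhood system; for a matrix $A\in\{0,1\}^{m\times n}$ it is the maximum of the VC-dimensions of its column system $([m],\{\{i:A_{i,j}=1\}:j\in[n]\})$ and row system $([n],\{\{j:A_{i,j}=1\}:i\in[m]\})$. (A function $e$ as in the claim exists by a theorem of Nguyen, Scott and Seymour.) -}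

module Defs where

open import Data.Nat using (ℕ; zero; suc; _+_; _*_; _^_; _≤_; _<_)
open import Data.Bool using (Bool; true; false)
open import Data.Fin as F using (Fin; combine)
open import Data.Fin.Subset using (Subset; _∈_; _⊆_; ∣_∣)
open import Data.Product using (Σ; ∃; _×_; _,_)
open import Data.Sum using (_⊎_)
open import Relation.Binary.PropositionalEquality using (_≡_; _≢_)
open import Relation.Nullary using (¬_)
open import Function.Bundles using (_⇔_)
open import Function.Definitions using (Injective)

-- Positive real numbers, given by their lower Dedekind cut of positive
-- rationals.  `Below r a b` means  (suc a)/(suc b) < r.

record PosReal : Set₁ where
  field
    Below     : ℕ → ℕ → Set
    down      : ∀ {a b c d} → suc c * suc b ≤ suc a * suc d → Below a b → Below c d
    inhabited : Σ ℕ λ a → Σ ℕ λ b → Below a b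
    rounded   : ∀ {a b} → Below a b →
                Σ ℕ λ c → Σ ℕ λ d → Below c d × (suc a * suc d < suc c * suc b)
    bounded   : Σ ℕ λ a → Σ ℕ λ b → ¬ Below a b
open PosReal public

-- `AtLeastPow m N r` means  m ≥ N ^ r  (for naturals m, N and real r > 0):
-- for every rational p/q < r we have N^p ≤ m^q.
AtLeastPow : ℕ → ℕ → PosReal → Set
AtLeastPow m N r = ∀ a b → Below r a b → N ^ suc a ≤ m ^ suc b

-- Set systems and VC-dimension.
-- Ground set Fin p, family indexed by Fin q; `mem j x ≡ true` iff x ∈ S_j.

Shattered : ∀ {p q} → (Fin q → Fin p → Bool) → Subset p → Set
Shattered {p} {q} mem Y =
  ∀ (Z : Subset p) → Z ⊆ Y →
    Σ (Fin q) λ j → ∀ x → x ∈ Y → ((x ∈ Z) ⇔ (mem j x ≡ true))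

VCdim≤ : ∀ {p q} → (Fin q → Fin p → Bool) → ℕ → Set
VCdim≤ {p} mem k = ∀ (Y : Subset p) → Shattered mem Y → ∣ Y ∣ ≤ k

record Graph (N : ℕ) : Set where
  field
    adj     : Fin N → Fin N → Bool
    sym     : ∀ u v → adj u v ≡ adj v u
    irrefl  : ∀ v → adj v v ≡ false
open Graph public

GraphVCdim≤ : ∀ {N} → Graph N → ℕ → Set
GraphVCdim≤ G k = VCdim≤ (adj G) k

IsClique : ∀ {N} → Graph N → Subset N → Set
IsClique G S = ∀ u v → u ∈ S → v ∈ S → u ≢ v → adj G u v ≡ true

IsIndependent : ∀ {N} → Graph N → Subset N → Set
IsIndependent G S = ∀ u v → u ∈ S → v ∈ S → u ≢ v → adj G u v ≡ false

MatVCdim≤ : ∀ {m n} → (Fin m → Fin n → Bool) → ℕ → Set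
MatVCdim≤ A d = VCdim≤ (λ j i → A i j) d × VCdim≤ (λ i j → A i j) d

-- Columns of an s × 2s matrix: (1-based) column 2j-1 is `colL j`,
-- column 2j is `colR j`, i.e. 0-based columns 2j and 2j+1.
colL colR : ∀ {s} → Fin s → Fin (s * 2)
colL j = combine j F.zero
colR j = combine j (F.suc F.zero)

IsSwitch : ∀ {s} → (Fin s → Fin (s * 2) → Bool) → Set
IsSwitch {s} B =
  (∀ i → B i (colL i) ≡ false × B i (colR i) ≡ true) ×
  (∀ (i j : Fin s) → i F.< j → B i (colL j) ≡ B i (colR j))

-- A square t×t submatrix of A (rows and columns chosen injectively, in
-- any order) that is an (α,β,*)-matrix.
HasABStarSubmatrix : ∀ {m n} → (Fin m → Fin n → Bool) → ℕ → Bool → Bool → Set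
HasABStarSubmatrix {m} {n} A t α β =
  Σ (Fin t → Fin m) λ r → Σ (Fin t → Fin n) λ c →
    Injective _≡_ _≡_ r × Injective _≡_ _≡_ c ×
    (∀ i j → i F.< j → A (r i) (c j) ≡ α) ×
    (∀ i → A (r i) (c i) ≡ β)

-- The hypothesis on e (Nguyen–Scott–Seymour type Erdős–Hajnal bound).
EHFunction : (ℕ → PosReal) → Set
EHFunction e =
  ∀ (k : ℕ) → 1 ≤ k → ∀ (N : ℕ) (G : Graph N) → GraphVCdim≤ G k →
    Σ (Subset N) λ S → (IsClique G S ⊎ IsIndependent G S) × AtLeastPow ∣ S ∣ N (e k)

-- Let L be the n × n matrix L u v = A u (2v-1), and G the graph on [n] in which u < v are
-- adjacent iff L u v = 1.  A clique of G, listed increasingly, gives rows u and columns 2u-1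
-- forming a (1,0,*)-submatrix; an independent set gives, via the switch property
-- A u (2v-1) = A u (2v), rows u and columns 2u forming a (0,1,*)-submatrix.  So it suffices
-- that G has VC-dimension at most 2d+1.  If Y were shattered with |Y| ≥ 2d+2, split it into
-- its first d+1 elements P and the rest Q.  As L has VC-dimension at most d, some Z₁ ⊆ P is
-- cut out by no column of L and some Z₂ ⊆ Q by no row of L.  But a vertex v whose
-- neighbourhood cuts Z₁ ∪ Z₂ out of Y either lies below all of Q, and then row v cuts out Z₂,
-- or above all of P, and then column v cuts out Z₁.
module Submission where

open import Defs
open import Data.Nat using (ℕ; _+_; _*_)
open import Data.Bool using (Bool)
open import Data.Fin using (Fin)
open import Data.Product using (Σ; _×_)
open import Relation.Binary.PropositionalEquality using (_≢_)
open import Data.Nat as ℕ using (zero; suc; z≤n; s≤s)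
import Data.Nat.Properties as ℕ
open import Data.Nat.Tactic.RingSolver using (solve-∀)
open import Data.Bool using (true; false) renaming (_≟_ to _≟ᵇ_)
open import Data.Fin as F using (zero; suc)
open import Data.Fin.Properties using (<-cmp; _≤?_; any?; decFinSubset; <⇒≢; combine-injectiveˡ)
open import Data.Fin.Subset using (Subset; _∈_; _∉_; _⊆_; _∪_; ∣_∣) renaming (⊥ to ∅)
open import Data.Fin.Subset.Properties using (∉⊥; _∈?_; _⊆?_; anySubset?; x∈p∪q⁻; p⊆p∪q; q⊆p∪q)
open import Data.Vec using (_∷_; []; here; there)
open import Data.Product using (∃; _,_; proj₁; proj₂; uncurry)
open import Data.Sum using (_⊎_; inj₁; inj₂; [_,_]′)
open import Data.Empty using (⊥; ⊥-elim)
open import Function using (_∘_; case_of_)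
open import Function.Bundles using (_⇔_; mk⇔; Equivalence)
import Function.Properties.Equivalence as ⇔
open import Function.Definitions using (Injective)
open import Relation.Binary.Definitions using (Tri; tri<; tri≈; tri>)
open import Relation.Binary.PropositionalEquality
  using (_≡_; refl; trans; cong; subst) renaming (sym to ≡-sym)
open import Relation.Nullary using (¬_; Dec; yes; no)
open import Relation.Nullary.Decidable using (map′; _×-dec_; _→-dec_; ¬?; decidable-stable)

private
  variable
    n p q : ℕ

CutsOut : (Fin q → Fin p → Bool) → Fin q → Subset p → Subset p → Set
CutsOut mem j Y Z = ∀ x → x ∈ Y → ((x ∈ Z) ⇔ (mem j x ≡ true))

_⇔?_ : {A B : Set} → Dec A → Dec B → Dec (A ⇔ B)
a? ⇔? b? = map′ (uncurry mk⇔) (λ e → Equivalence.to e , Equivalence.from e)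
                ((a? →-dec b?) ×-dec (b? →-dec a?))

cutsOut? : (mem : Fin q → Fin p → Bool) → ∀ j Y Z → Dec (CutsOut mem j Y Z)
cutsOut? mem j Y Z = map′ (λ f x → f {x}) (λ f {x} → f x)
  (decFinSubset (_∈? Y) (λ {x} _ → (x ∈? Z) ⇔? (mem j x ≟ᵇ true)))

shattered⊎uncut : (mem : Fin q → Fin p → Bool) (Y : Subset p) →
  Shattered mem Y ⊎ ∃ λ Z → Z ⊆ Y × ¬ ∃ λ j → CutsOut mem j Y Z
shattered⊎uncut mem Y = case anySubset? (λ Z → (Z ⊆? Y) ×-dec ¬? (cut? Z)) of λ where
    (yes uncut) → inj₂ uncut
    (no ¬uncut) → inj₁ λ Z (Z⊆Y : Z ⊆ Y) →
      decidable-stable (cut? Z) (λ ¬cut → ¬uncut (Z , Z⊆Y , ¬cut))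
  where
  cut? : ∀ Z → Dec (∃ λ j → CutsOut mem j Y Z)
  cut? Z = any? (λ j → cutsOut? mem j Y Z)

VCdim≤-subfamily : ∀ {q′} {mem : Fin q → Fin p → Bool} {k} (f : Fin q′ → Fin q) →
  VCdim≤ mem k → VCdim≤ (mem ∘ f) k
VCdim≤-subfamily f vc Y sh = vc Y λ Z Z⊆Y → let j , cut = sh Z Z⊆Y in f j , cut

takeFirst dropFirst : ℕ → Subset n → Subset n
takeFirst k       []            = []
takeFirst zero    S             = ∅
takeFirst (suc k) (true  ∷ S)   = true  ∷ takeFirst k S
takeFirst (suc k) (false ∷ S)   = false ∷ takeFirst (suc k) S

dropFirst k       []            = []
dropFirst zero    S             = S
dropFirst (suc k) (true  ∷ S)   = false ∷ dropFirst k S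
dropFirst (suc k) (false ∷ S)   = false ∷ dropFirst (suc k) S

takeFirst⊆ : ∀ k (S : Subset n) → takeFirst k S ⊆ S
takeFirst⊆ zero    (b ∷ S)     x∈  = ⊥-elim (∉⊥ x∈)
takeFirst⊆ (suc k) (true  ∷ S) here = here
takeFirst⊆ (suc k) (true  ∷ S) (there x∈) = there (takeFirst⊆ k S x∈)
takeFirst⊆ (suc k) (false ∷ S) (there x∈) = there (takeFirst⊆ (suc k) S x∈)

dropFirst⊆ : ∀ k (S : Subset n) → dropFirst k S ⊆ S
dropFirst⊆ zero    (b ∷ S)     y∈ = y∈
dropFirst⊆ (suc k) (true  ∷ S) (there y∈) = there (dropFirst⊆ k S y∈)
dropFirst⊆ (suc k) (false ∷ S) (there y∈) = there (dropFirst⊆ (suc k) S y∈)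

takeFirst<dropFirst : ∀ k (S : Subset n) {x y} →
  x ∈ takeFirst k S → y ∈ dropFirst k S → x F.< y
takeFirst<dropFirst zero    (b ∷ S)     x∈         _          = ⊥-elim (∉⊥ x∈)
takeFirst<dropFirst (suc k) (true  ∷ S) here       (there _)  = ℕ.z<s
takeFirst<dropFirst (suc k) (true  ∷ S) (there x∈) (there y∈) =
  ℕ.s<s (takeFirst<dropFirst k S x∈ y∈)
takeFirst<dropFirst (suc k) (false ∷ S) (there x∈) (there y∈) =
  ℕ.s<s (takeFirst<dropFirst (suc k) S x∈ y∈)

∣takeFirst∣ : ∀ k (S : Subset n) → k ℕ.≤ ∣ S ∣ → k ℕ.≤ ∣ takeFirst k S ∣
∣takeFirst∣ zero    S           _         = z≤n
∣takeFirst∣ (suc k) (true  ∷ S) (s≤s k≤) = s≤s (∣takeFirst∣ k S k≤)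
∣takeFirst∣ (suc k) (false ∷ S) k≤       = ∣takeFirst∣ (suc k) S k≤

∣dropFirst∣ : ∀ k (S : Subset n) → ∣ S ∣ ℕ.≤ k + ∣ dropFirst k S ∣
∣dropFirst∣ k       []          = z≤n
∣dropFirst∣ zero    (b ∷ S)     = ℕ.≤-refl
∣dropFirst∣ (suc k) (true  ∷ S) = s≤s (∣dropFirst∣ k S)
∣dropFirst∣ (suc k) (false ∷ S) = ∣dropFirst∣ (suc k) S

colL-image : Subset n → Subset (n * 2)
colL-image []      = []
colL-image (b ∷ S) = b ∷ false ∷ colL-image S

colL-preimage : Subset (n * 2) → Subset n
colL-preimage {zero}  []          = []
colL-preimage {suc n} (a ∷ _ ∷ T) = a ∷ colL-preimage T

∣colL-image∣ : (S : Subset n) → ∣ colL-image S ∣ ≡ ∣ S ∣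
∣colL-image∣ []          = refl
∣colL-image∣ (true  ∷ S) = cong suc (∣colL-image∣ S)
∣colL-image∣ (false ∷ S) = ∣colL-image∣ S

∀∈colL-image : (S : Subset n) {P : Fin (n * 2) → Set} →
  (∀ u → u ∈ S → P (colL u)) → ∀ y → y ∈ colL-image S → P y
∀∈colL-image (true ∷ S) f zero          here               = f zero here
∀∈colL-image (b    ∷ S) f (suc (suc y)) (there (there y∈)) =
  ∀∈colL-image S (λ u u∈ → f (suc u) (there u∈)) y y∈

colL∈colL-image⁻ : (S : Subset n) {u : Fin n} → colL u ∈ colL-image S → u ∈ S
colL∈colL-image⁻ (true ∷ S) {zero}  here               = here
colL∈colL-image⁻ (b    ∷ S) {suc u} (there (there u∈)) = there (colL∈colL-image⁻ S u∈)

∈-colL-preimage : (T : Subset (n * 2)) {u : Fin n} → u ∈ colL-preimage T ⇔ colL u ∈ T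
∈-colL-preimage T = mk⇔ (to T) (from T)
  where
  to : ∀ {n} (T : Subset (n * 2)) {u : Fin n} → u ∈ colL-preimage T → colL u ∈ T
  to {suc n} (true ∷ _ ∷ T) {zero}  here     = here
  to {suc n} (_    ∷ _ ∷ T) {suc u} (there p) = there (there (to T p))
  from : ∀ {n} (T : Subset (n * 2)) {u : Fin n} → colL u ∈ T → u ∈ colL-preimage T
  from {suc n} (true ∷ _ ∷ T) {zero}  here              = here
  from {suc n} (_    ∷ _ ∷ T) {suc u} (there (there p)) = there (from T p)

leftBlock : (Fin n → Fin (n * 2) → Bool) → Fin n → Fin n → Bool
leftBlock A u v = A u (colL v)

leftBlock-VCdim≤ : ∀ (A : Fin n → Fin (n * 2) → Bool) {d} →
  MatVCdim≤ A d → MatVCdim≤ (leftBlock A) d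
leftBlock-VCdim≤ A (colVC , rowVC) = VCdim≤-subfamily colL colVC , rowVC′
  where
  rowVC′ : VCdim≤ (leftBlock A) _
  rowVC′ Q sh = subst (ℕ._≤ _) (∣colL-image∣ Q) (rowVC (colL-image Q) λ Z Z⊆ →
    let i , cut = sh (colL-preimage Z)
                     (colL∈colL-image⁻ Q ∘ Z⊆ ∘ Equivalence.to (∈-colL-preimage Z))
    in i , ∀∈colL-image Q λ u u∈ → ⇔.trans (⇔.sym (∈-colL-preimage Z)) (cut u u∈))

below⊎above : (v : Fin n) (P : Subset n) →
  (∃ λ x → x ∈ P × v F.≤ x) ⊎ (∀ {x} → x ∈ P → x F.< v)
below⊎above v P with any? (λ x → (x ∈? P) ×-dec (v ≤? x))
... | yes below = inj₁ below
... | no ¬below = inj₂ λ {x} x∈P → ℕ.≰⇒> λ v≤x → ¬below (x , x∈P , v≤x)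

module UpperGraph (M : Fin n → Fin n → Bool) where

  upperAdj : Fin n → Fin n → Bool
  upperAdj u v with <-cmp u v
  ... | tri< _ _ _ = M u v
  ... | tri≈ _ _ _ = false
  ... | tri> _ _ _ = M v u

  upperAdj-< : ∀ {u v} → u F.< v → upperAdj u v ≡ M u v
  upperAdj-< {u} {v} u<v with <-cmp u v
  ... | tri< _ _ _  = refl
  ... | tri≈ ¬u<v _ _ = ⊥-elim (¬u<v u<v)
  ... | tri> ¬u<v _ _ = ⊥-elim (¬u<v u<v)

  upperAdj-> : ∀ {u v} → v F.< u → upperAdj u v ≡ M v u
  upperAdj-> {u} {v} v<u with <-cmp u v
  ... | tri< _ _ ¬v<u = ⊥-elim (¬v<u v<u)
  ... | tri≈ _ _ ¬v<u = ⊥-elim (¬v<u v<u)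
  ... | tri> _ _ _    = refl

  upperGraph : Graph n
  upperGraph = record { adj = upperAdj ; sym = upperAdj-sym ; irrefl = upperAdj-irrefl }
    where
    upperAdj-sym : ∀ u v → upperAdj u v ≡ upperAdj v u
    upperAdj-sym u v = bySide (<-cmp u v)
      where
      bySide : Tri (u F.< v) (u ≡ v) (v F.< u) → upperAdj u v ≡ upperAdj v u
      bySide (tri< u<v _ _) = trans (upperAdj-< u<v) (≡-sym (upperAdj-> u<v))
      bySide (tri≈ _ refl _) = refl
      bySide (tri> _ _ v<u) = trans (upperAdj-> v<u) (≡-sym (upperAdj-< v<u))
    upperAdj-irrefl : ∀ v → upperAdj v v ≡ false
    upperAdj-irrefl v with <-cmp v v
    ... | tri< _ v≢v _ = ⊥-elim (v≢v refl)
    ... | tri≈ _ _ _   = refl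
    ... | tri> _ v≢v _ = ⊥-elim (v≢v refl)

  uncutParts⇒¬shattered : ∀ {Y P Q Z₁ Z₂} → Shattered upperAdj Y → P ⊆ Y → Q ⊆ Y →
    (∀ {x y} → x ∈ P → y ∈ Q → x F.< y) → Z₁ ⊆ P → Z₂ ⊆ Q →
    ¬ (∃ λ j → CutsOut (λ j i → M i j) j P Z₁) → ¬ (∃ λ i → CutsOut M i Q Z₂) → ⊥
  uncutParts⇒¬shattered {Y} {P} {Q} {Z₁} {Z₂} shY P⊆Y Q⊆Y P<Q Z₁⊆P Z₂⊆Q ¬cut₁ ¬cut₂ =
    case below⊎above v P of λ where
      (inj₁ (x₀ , x₀∈P , v≤x₀)) → ¬cut₂ (v , λ u u∈Q →
        ⇔.trans (onlyZ₂ u∈Q) (subst (λ b → _ ⇔ (b ≡ true))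
          (upperAdj-< (ℕ.≤-<-trans v≤x₀ (P<Q x₀∈P u∈Q))) (cutZ u (Q⊆Y u∈Q))))
      (inj₂ P<v) → ¬cut₁ (v , λ x x∈P →
        ⇔.trans (onlyZ₁ x∈P) (subst (λ b → _ ⇔ (b ≡ true))
          (upperAdj-> (P<v x∈P)) (cutZ x (P⊆Y x∈P))))
    where
    Z⊆Y : Z₁ ∪ Z₂ ⊆ Y
    Z⊆Y x∈ with x∈p∪q⁻ Z₁ Z₂ x∈
    ... | inj₁ x∈Z₁ = P⊆Y (Z₁⊆P x∈Z₁)
    ... | inj₂ x∈Z₂ = Q⊆Y (Z₂⊆Q x∈Z₂)
    v = proj₁ (shY (Z₁ ∪ Z₂) Z⊆Y)
    cutZ : CutsOut upperAdj v Y (Z₁ ∪ Z₂)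
    cutZ = proj₂ (shY (Z₁ ∪ Z₂) Z⊆Y)
    P∩Q≡∅ : ∀ {x} → x ∈ P → x ∉ Q
    P∩Q≡∅ x∈P x∈Q = <⇒≢ (P<Q x∈P x∈Q) refl
    onlyZ₁ : ∀ {x} → x ∈ P → x ∈ Z₁ ⇔ x ∈ Z₁ ∪ Z₂
    onlyZ₁ x∈P = mk⇔ (p⊆p∪q Z₂) λ x∈ → case x∈p∪q⁻ Z₁ Z₂ x∈ of λ where
      (inj₁ x∈Z₁) → x∈Z₁
      (inj₂ x∈Z₂) → ⊥-elim (P∩Q≡∅ x∈P (Z₂⊆Q x∈Z₂))
    onlyZ₂ : ∀ {x} → x ∈ Q → x ∈ Z₂ ⇔ x ∈ Z₁ ∪ Z₂
    onlyZ₂ x∈Q = mk⇔ (q⊆p∪q Z₁ Z₂) λ x∈ → case x∈p∪q⁻ Z₁ Z₂ x∈ of λ where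
      (inj₁ x∈Z₁) → ⊥-elim (P∩Q≡∅ (Z₁⊆P x∈Z₁) x∈Q)
      (inj₂ x∈Z₂) → x∈Z₂

  shattered⇒colsShatter⊎rowsShatter : ∀ {Y P Q} → Shattered upperAdj Y → P ⊆ Y → Q ⊆ Y →
    (∀ {x y} → x ∈ P → y ∈ Q → x F.< y) →
    Shattered (λ j i → M i j) P ⊎ Shattered M Q
  shattered⇒colsShatter⊎rowsShatter {Y} {P} {Q} shY P⊆Y Q⊆Y P<Q
    with shattered⊎uncut (λ j i → M i j) P | shattered⊎uncut M Q
  ... | inj₁ shP | _ = inj₁ shP
  ... | _ | inj₁ shQ = inj₂ shQ
  ... | inj₂ (_ , Z₁⊆P , ¬cut₁) | inj₂ (_ , Z₂⊆Q , ¬cut₂) =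
    ⊥-elim (uncutParts⇒¬shattered shY P⊆Y Q⊆Y P<Q Z₁⊆P Z₂⊆Q ¬cut₁ ¬cut₂)

  upperGraph-VCdim≤ : ∀ {d} → MatVCdim≤ M d → GraphVCdim≤ upperGraph (d + suc d)
  upperGraph-VCdim≤ {d} (colVC , rowVC) Y shY with ∣ Y ∣ ℕ.≤? d + suc d
  ... | yes ∣Y∣≤ = ∣Y∣≤
  ... | no ∣Y∣≰ = ⊥-elim
    ([ (λ shP → ℕ.<⇒≱ d<∣P∣ (colVC P shP)) , (λ shQ → ℕ.<⇒≱ d<∣Q∣ (rowVC Q shQ)) ]′
      (shattered⇒colsShatter⊎rowsShatter shY (takeFirst⊆ (suc d) Y) (dropFirst⊆ (suc d) Y)
        (takeFirst<dropFirst (suc d) Y)))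
    where
    P Q : Subset n
    P = takeFirst (suc d) Y
    Q = dropFirst (suc d) Y
    2d+2≤∣Y∣ : suc d + suc d ℕ.≤ ∣ Y ∣
    2d+2≤∣Y∣ = ℕ.≰⇒> ∣Y∣≰
    d<∣P∣ : d ℕ.< ∣ P ∣
    d<∣P∣ = ∣takeFirst∣ (suc d) Y (ℕ.≤-trans (ℕ.m≤m+n (suc d) (suc d)) 2d+2≤∣Y∣)
    d<∣Q∣ : d ℕ.< ∣ Q ∣
    d<∣Q∣ = ℕ.+-cancelˡ-≤ (suc d) (suc d) ∣ Q ∣ (ℕ.≤-trans 2d+2≤∣Y∣ (∣dropFirst∣ (suc d) Y))

enum : (S : Subset n) → Fin ∣ S ∣ → Fin n
enum (true  ∷ S) zero    = zero
enum (true  ∷ S) (suc i) = suc (enum S i)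
enum (false ∷ S) i       = suc (enum S i)

enum-∈ : (S : Subset n) (i : Fin ∣ S ∣) → enum S i ∈ S
enum-∈ (true  ∷ S) zero    = here
enum-∈ (true  ∷ S) (suc i) = there (enum-∈ S i)
enum-∈ (false ∷ S) i       = there (enum-∈ S i)

enum-strictMono : (S : Subset n) {i j : Fin ∣ S ∣} → i F.< j → enum S i F.< enum S j
enum-strictMono (true  ∷ S) {zero}  {suc j} _   = ℕ.z<s
enum-strictMono (true  ∷ S) {suc i} {suc j} i<j = ℕ.s<s (enum-strictMono S (ℕ.s<s⁻¹ i<j))
enum-strictMono (false ∷ S) i<j                 = ℕ.s<s (enum-strictMono S i<j)

enum-injective : (S : Subset n) → Injective _≡_ _≡_ (enum S)
enum-injective S {i} {j} eq with <-cmp i j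
... | tri< i<j _ _ = ⊥-elim (<⇒≢ (enum-strictMono S i<j) eq)
... | tri≈ _ i≡j _ = i≡j
... | tri> _ _ j<i = ⊥-elim (<⇒≢ (enum-strictMono S j<i) (≡-sym eq))

module _ (A : Fin n → Fin (n * 2) → Bool) (switch : IsSwitch A) (S : Subset n) where
  open UpperGraph (leftBlock A)

  clique⇒submatrix : IsClique upperGraph S → HasABStarSubmatrix A ∣ S ∣ true false
  clique⇒submatrix clique =
    enum S , colL ∘ enum S ,
    enum-injective S , enum-injective S ∘ combine-injectiveˡ _ zero _ zero ,
    (λ i j i<j → let u<v = enum-strictMono S i<j in
      trans (≡-sym (upperAdj-< u<v)) (clique _ _ (enum-∈ S i) (enum-∈ S j) (<⇒≢ u<v))) ,
    (λ i → proj₁ (proj₁ switch (enum S i)))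

  independent⇒submatrix : IsIndependent upperGraph S → HasABStarSubmatrix A ∣ S ∣ false true
  independent⇒submatrix independent =
    enum S , colR ∘ enum S ,
    enum-injective S , enum-injective S ∘ combine-injectiveˡ _ (suc zero) _ (suc zero) ,
    (λ i j i<j → let u<v = enum-strictMono S i<j in
      trans (≡-sym (proj₂ switch _ _ u<v))
        (trans (≡-sym (upperAdj-< u<v)) (independent _ _ (enum-∈ S i) (enum-∈ S j) (<⇒≢ u<v)))) ,
    (λ i → proj₂ (proj₁ switch (enum S i)))

d+1+d≤4d+3 : ∀ d → d + suc d ℕ.≤ 4 * d + 3
d+1+d≤4d+3 d = subst (d + suc d ℕ.≤_) (eq d) (ℕ.m≤m+n (d + suc d) (d + d + 2))
  where
  eq : ∀ d → d + suc d + (d + d + 2) ≡ 4 * d + 3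
  eq = solve-∀

lemma3 : (e : ℕ → PosReal) → EHFunction e →
    (d n : ℕ) (A : Fin n → Fin (n * 2) → Bool) → IsSwitch A → MatVCdim≤ A d →
    Σ ℕ λ t → Σ Bool λ α → Σ Bool λ β →
      (α ≢ β) × HasABStarSubmatrix A t α β × AtLeastPow t n (e (4 * d + 3))
lemma3 e erdősHajnal d n A switch vc
  with erdősHajnal (4 * d + 3) (ℕ.≤-trans (s≤s z≤n) (ℕ.m≤n+m 3 (4 * d))) n upperGraph
         (λ Y sh → ℕ.≤-trans (upperGraph-VCdim≤ (leftBlock-VCdim≤ A vc) Y sh) (d+1+d≤4d+3 d))
  where open UpperGraph (leftBlock A)
... | S , inj₁ clique , big =
  ∣ S ∣ , true , false , (λ ()) , clique⇒submatrix A switch S clique , big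
... | S , inj₂ independent , big =
  ∣ S ∣ , false , true , (λ ()) , independent⇒submatrix A switch S independent , big
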